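{- Let $\Gamma\subseteq\mathcal{L}_{NF}$ be a finite set, $\varphi\in\mathcal{L}_{NF}$ and $\gamma\in\mathcal{G}_{NF}$. If $\mathsf{Full}\vdash\bigvee\Gamma\lor\big(\varphi\land\langle\gamma\rangle\langle(\overline\Gamma!;\gamma)^\times\rangle\langle\overline\Gamma!\rangle\varphi\big)$, then $\mathsf{Full}\vdash\bigvee\Gamma\lor\langle\gamma^\times\rangle\varphi$.
   Context: Fix countable $\mathsf{P}_0$, $\mathsf{G}_0$. $\mathcal{L}_{NF}$/$\mathcal{G}_{NF}$: $\varphi ::= p \mid \neg p \mid \varphi\lor\varphi \mid \varphi\land\varphi \mid \langle\gamma\rangle\varphi$, $\gamma ::= g \mid g^d \mid \gamma;\gamma \mid \gamma\sqcup\gamma \mid \gamma\sqcap\gamma \mid \gamma^* \mid \gamma^\times \mid \varphi? \mid \varphi!$. $\mathcal{L}_{Full}$: $\varphi ::= p \mid \neg\varphi \mid \varphi\lor\varphi \mid \langle\gamma\rangle\varphi$, $\gamma ::= g \mid \gamma;\gamma \mid \gamma\sqcup\gamma \mid \gamma\sqcap\gamma \mid \gamma^* \mid \gamma^\times \mid \gamma^d \mid \varphi? \mid \varphi!$, with $\land,\to,\leftrightarrow$ abbreviations, so $\mathcal{L}_{NF}\subseteq\mathcal{L}_{Full}$. Complement on $\mathcal{L}_{NF}$: $\overline p=\neg p$, $\overline{\neg p}=p$, $\overline{\varphi\lor\psi}=\overline\varphi\land\overline\psi$, $\overline{\varphi\land\psi}=\overline\varphi\lor\overline\psi$, $\overline{\langle\gamma\rangle\varphi}=\langle\check\gamma\rangle\overline\varphi$,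 with $\check g=g^d$, $\check{(g^d)}=g$, $\check{(\gamma;\delta)}=\check\gamma;\check\delta$, $\check{(\gamma\sqcup\delta)}=\check\gamma\sqcap\check\delta$, $\check{(\gamma\sqcap\delta)}=\check\gamma\sqcup\check\delta$, $\check{(\gamma^*)}=(\check\gamma)^\times$, $\check{(\gamma^\times)}=(\check\gamma)^*$, $\check{(\varphi?)}=\overline\varphi!$, $\check{(\varphi!)}=\overline\varphi?$; for $\Gamma=\{\psi_1,\dots,\psi_n\}$, $\overline\Gamma=\overline{\psi_1}\land\dots\land\overline{\psi_n}$. $\mathsf{Full}$: Hilbert system over $\mathcal{L}_{Full}$ with axioms: propositional tautologies; $\langle\gamma;\delta\rangle\varphi\leftrightarrow\langle\gamma\rangle\langle\delta\rangle\varphi$; $\langle\gamma\sqcup\delta\rangle\varphi\leftrightarrow\langle\gamma\rangle\varphi\lor\langle\delta\rangle\varphi$; $\langle\gamma^*\rangle\varphi\leftrightarrow\varphi\lor\langle\gamma\rangle\langle\gamma^*\rangle\varphi$; $\langle\psi?\rangle\varphi\leftrightarrow\psi\land\varphi$; $\langle\gamma^d\rangle\varphi\leftrightarrow\neg\langle\gamma\rangle\neg\varphi$; $\langle\gamma\sqcap\delta\rangle\varphi\leftrightarrow\langle\gamma\rangle\varphi\land\langle\delta\rangle\varphi$; $\langle\gamma^\times\rangle\varphi\leftrightarrow\varphi\land\langle\gamma\rangle\langle\gamma^\times\rangle\varphi$; $\langle\psi!\rangle\varphi\leftrightarrow\psi\lor\varphi$; rules: modus ponens; from $\varphi\to\psi$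 infer $\langle\gamma\rangle\varphi\to\langle\gamma\rangle\psi$; from $\langle\gamma\rangle\varphi\to\varphi$ infer $\langle\gamma^*\rangle\varphi\to\varphi$; from $\varphi\to\langle\gamma\rangle\varphi$ infer $\varphi\to\langle\gamma^\times\rangle\varphi$. -}

module Defs where

open import Data.Nat using (ℕ)
open import Data.Bool using (Bool; true; false; not; _∨_)
open import Data.List using (List; []; _∷_)
open import Relation.Binary.PropositionalEquality using (_≡_)

-- Atoms: P₀ and G₀ are countable; we take both to be ℕ.

Prop₀ : Set
Prop₀ = ℕ

Game₀ : Set
Game₀ = ℕ

data Fm : Set
data Gm : Set

data Fm where
  atom : Prop₀ → Fm
  ¬ᶠ_  : Fm → Fm
  _∨ᶠ_ : Fm → Fm → Fm
  ⟨_⟩_ : Gm → Fm → Fm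

data Gm where
  gatom : Game₀ → Gm
  _︔_  : Gm → Gm → Gm
  _⊔_  : Gm → Gm → Gm
  _⊓_  : Gm → Gm → Gm
  _*   : Gm → Gm
  _×ᵍ  : Gm → Gm
  _ᵈ   : Gm → Gm
  _¿   : Fm → Gm
  _‼   : Fm → Gm

infix  40 ¬ᶠ_
infixr 40 ⟨_⟩_
infixr 30 _∨ᶠ_
infixr 31 _∧ᶠ_
infixr 29 _⇒_
infix  28 _⇔_

_∧ᶠ_ : Fm → Fm → Fm
φ ∧ᶠ ψ = ¬ᶠ (¬ᶠ φ ∨ᶠ ¬ᶠ ψ)

_⇒_ : Fm → Fm → Fm
φ ⇒ ψ = ¬ᶠ φ ∨ᶠ ψ

_⇔_ : Fm → Fm → Fm
φ ⇔ ψ = (φ ⇒ ψ) ∧ᶠ (ψ ⇒ φ)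

⊤ᶠ : Fm
⊤ᶠ = ¬ᶠ atom 0 ∨ᶠ atom 0

⊥ᶠ : Fm
⊥ᶠ = ¬ᶠ ⊤ᶠ

evalP : (Fm → Bool) → Fm → Bool
evalP v (atom p)  = v (atom p)
evalP v (¬ᶠ φ)    = not (evalP v φ)
evalP v (φ ∨ᶠ ψ)  = evalP v φ ∨ evalP v ψ
evalP v (⟨ γ ⟩ φ) = v (⟨ γ ⟩ φ)

Tautology : Fm → Set
Tautology φ = (v : Fm → Bool) → evalP v φ ≡ true

data ⊢_ : Fm → Set where
  taut   : ∀ {φ} → Tautology φ → ⊢ φ
  ax-seq : ∀ {γ δ φ} → ⊢ (⟨ γ ︔ δ ⟩ φ ⇔ ⟨ γ ⟩ ⟨ δ ⟩ φ)
  ax-⊔   : ∀ {γ δ φ} → ⊢ (⟨ γ ⊔ δ ⟩ φ ⇔ (⟨ γ ⟩ φ ∨ᶠ ⟨ δ ⟩ φ))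
  ax-*   : ∀ {γ φ} → ⊢ (⟨ γ * ⟩ φ ⇔ (φ ∨ᶠ ⟨ γ ⟩ ⟨ γ * ⟩ φ))
  ax-?   : ∀ {ψ φ} → ⊢ (⟨ ψ ¿ ⟩ φ ⇔ (ψ ∧ᶠ φ))
  ax-d   : ∀ {γ φ} → ⊢ (⟨ γ ᵈ ⟩ φ ⇔ ¬ᶠ ⟨ γ ⟩ (¬ᶠ φ))
  ax-⊓   : ∀ {γ δ φ} → ⊢ (⟨ γ ⊓ δ ⟩ φ ⇔ (⟨ γ ⟩ φ ∧ᶠ ⟨ δ ⟩ φ))
  ax-×   : ∀ {γ φ} → ⊢ (⟨ γ ×ᵍ ⟩ φ ⇔ (φ ∧ᶠ ⟨ γ ⟩ ⟨ γ ×ᵍ ⟩ φ))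
  ax-!   : ∀ {ψ φ} → ⊢ (⟨ ψ ‼ ⟩ φ ⇔ (ψ ∨ᶠ φ))
  mp     : ∀ {φ ψ} → ⊢ (φ ⇒ ψ) → ⊢ φ → ⊢ ψ
  mono   : ∀ {γ φ ψ} → ⊢ (φ ⇒ ψ) → ⊢ (⟨ γ ⟩ φ ⇒ ⟨ γ ⟩ ψ)
  ind-*  : ∀ {γ φ} → ⊢ (⟨ γ ⟩ φ ⇒ φ) → ⊢ (⟨ γ * ⟩ φ ⇒ φ)
  ind-×  : ∀ {γ φ} → ⊢ (φ ⇒ ⟨ γ ⟩ φ) → ⊢ (φ ⇒ ⟨ γ ×ᵍ ⟩ φ)

data NFm : Set
data NGm : Set

data NFm where
  pos  : Prop₀ → NFm
  neg  : Prop₀ → NFm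
  _∨ⁿ_ : NFm → NFm → NFm
  _∧ⁿ_ : NFm → NFm → NFm
  ⟪_⟫_ : NGm → NFm → NFm

data NGm where
  ng    : Game₀ → NGm
  ngd   : Game₀ → NGm
  _︔ⁿ_ : NGm → NGm → NGm
  _⊔ⁿ_ : NGm → NGm → NGm
  _⊓ⁿ_ : NGm → NGm → NGm
  _*ⁿ  : NGm → NGm
  _×ⁿ  : NGm → NGm
  _?ⁿ  : NFm → NGm
  _!ⁿ  : NFm → NGm

⌜_⌝  : NFm → Fm
⌜_⌝ᵍ : NGm → Gm
⌜ pos p ⌝     = atom p
⌜ neg p ⌝     = ¬ᶠ atom p
⌜ φ ∨ⁿ ψ ⌝    = ⌜ φ ⌝ ∨ᶠ ⌜ ψ ⌝
⌜ φ ∧ⁿ ψ ⌝    = ⌜ φ ⌝ ∧ᶠ ⌜ ψ ⌝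
⌜ ⟪ γ ⟫ φ ⌝   = ⟨ ⌜ γ ⌝ᵍ ⟩ ⌜ φ ⌝
⌜ ng g ⌝ᵍ     = gatom g
⌜ ngd g ⌝ᵍ    = gatom g ᵈ
⌜ γ ︔ⁿ δ ⌝ᵍ   = ⌜ γ ⌝ᵍ ︔ ⌜ δ ⌝ᵍ
⌜ γ ⊔ⁿ δ ⌝ᵍ   = ⌜ γ ⌝ᵍ ⊔ ⌜ δ ⌝ᵍ
⌜ γ ⊓ⁿ δ ⌝ᵍ   = ⌜ γ ⌝ᵍ ⊓ ⌜ δ ⌝ᵍ
⌜ γ *ⁿ ⌝ᵍ     = ⌜ γ ⌝ᵍ *
⌜ γ ×ⁿ ⌝ᵍ     = ⌜ γ ⌝ᵍ ×ᵍ
⌜ φ ?ⁿ ⌝ᵍ     = ⌜ φ ⌝ ¿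
⌜ φ !ⁿ ⌝ᵍ     = ⌜ φ ⌝ ‼

compl  : NFm → NFm
complᵍ : NGm → NGm
compl (pos p)    = neg p
compl (neg p)    = pos p
compl (φ ∨ⁿ ψ)   = compl φ ∧ⁿ compl ψ
compl (φ ∧ⁿ ψ)   = compl φ ∨ⁿ compl ψ
compl (⟪ γ ⟫ φ)  = ⟪ complᵍ γ ⟫ compl φ
complᵍ (ng g)    = ngd g
complᵍ (ngd g)   = ng g
complᵍ (γ ︔ⁿ δ)  = complᵍ γ ︔ⁿ complᵍ δ
complᵍ (γ ⊔ⁿ δ)  = complᵍ γ ⊓ⁿ complᵍ δ
complᵍ (γ ⊓ⁿ δ)  = complᵍ γ ⊔ⁿ complᵍ δ
complᵍ (γ *ⁿ)    = complᵍ γ ×ⁿ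
complᵍ (γ ×ⁿ)    = complᵍ γ *ⁿ
complᵍ (φ ?ⁿ)    = compl φ !ⁿ
complᵍ (φ !ⁿ)    = compl φ ?ⁿ

-- Finite sets Γ as lists; ⋁Γ and the complement Γ̄ = ψ̄₁ ∧ … ∧ ψ̄ₙ.
-- Conventions for Γ = ∅: ⋁∅ = ⊥, Γ̄ = ⊤.

⋁ : List NFm → Fm
⋁ []           = ⊥ᶠ
⋁ (ψ ∷ [])     = ⌜ ψ ⌝
⋁ (ψ ∷ ψ′ ∷ Γ) = ⌜ ψ ⌝ ∨ᶠ ⋁ (ψ′ ∷ Γ)

complΓ : List NFm → Fm
complΓ []           = ⊤ᶠ
complΓ (ψ ∷ [])     = ⌜ compl ψ ⌝
complΓ (ψ ∷ ψ′ ∷ Γ) = ⌜ compl ψ ⌝ ∧ᶠ complΓ (ψ′ ∷ Γ)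

-- Write C for the complement of Γ and θ for ⟨(C!;γ)^×⟩⟨C!⟩φ. Since every
-- formula is provably incompatible with its complement, C excludes ⋁Γ, so
-- the hypothesis gives ⊢ C → φ ∧ ⟨γ⟩θ. Unfolding θ once shows
-- θ → C ∨ (φ ∧ ⟨γ⟩θ), hence θ → φ ∧ ⟨γ⟩θ. Thus φ ∧ ⟨γ⟩θ implies
-- ⟨γ⟩(φ ∧ ⟨γ⟩θ), and the induction rule for ×, applied to this
-- post-fixed point of ⟨γ⟩ that implies φ, yields φ ∧ ⟨γ⟩θ → ⟨γ^×⟩φ.
module Submission where

open import Defs
open import Data.Bool using (Bool; true; false; not; _∨_; _∧_; T)
open import Data.Bool.Properties using (T-≡; T-∧)
open import Data.List using (List; []; _∷_)
open import Data.Nat using (ℕ; zero; suc)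
open import Data.Product using (_,_)
open import Data.Vec using (Vec; []; _∷_)
open import Function.Bundles using (Equivalence)
open import Relation.Binary.PropositionalEquality using (_≡_; refl; trans)

open Equivalence using (to)

BoolFun : ℕ → Set
BoolFun zero    = Bool
BoolFun (suc n) = Bool → BoolFun n

valid : ∀ {n} → BoolFun n → Bool
valid {zero}  b = b
valid {suc n} f = valid (f true) ∧ valid (f false)

truthValue : ∀ {n} → BoolFun n → (Fm → Bool) → Vec Fm n → Bool
truthValue b v []       = b
truthValue f v (A ∷ As) = truthValue (f (evalP v A)) v As

valid-sound : ∀ {n} (f : BoolFun n) → T (valid f) → ∀ v As → T (truthValue f v As)
valid-sound {zero}  b t v []       = t
valid-sound {suc n} f t v (A ∷ As) with evalP v A | to T-∧ t
... | true  | t₁ , _ = valid-sound (f true) t₁ v As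
... | false | _ , t₂ = valid-sound (f false) t₂ v As

tautology : ∀ {n φ} (As : Vec Fm n) (f : BoolFun n) →
            (∀ v → evalP v φ ≡ truthValue f v As) → {T (valid f)} → ⊢ φ
tautology As f agree {t} = taut λ v → trans (agree v) (to T-≡ (valid-sound f t v As))

-- Boolean counterparts of ∧ᶠ, ⇒ and ⇔, defined by the same equations so
-- that truth tables written with them agree with evalP by refl.

infixr 6 _∧ᵇ_
infixr 4 _⇒ᵇ_

_∧ᵇ_ : Bool → Bool → Bool
a ∧ᵇ b = not (not a ∨ not b)

_⇒ᵇ_ : Bool → Bool → Bool
a ⇒ᵇ b = not a ∨ b

_⇔ᵇ_ : Bool → Bool → Bool
a ⇔ᵇ b = (a ⇒ᵇ b) ∧ᵇ (b ⇒ᵇ a)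

⇔-to : ∀ {A B} → ⊢ (A ⇔ B) → ⊢ (A ⇒ B)
⇔-to {A} {B} = mp (tautology (A ∷ B ∷ []) (λ a b → (a ⇔ᵇ b) ⇒ᵇ a ⇒ᵇ b) λ _ → refl)

⇒-trans : ∀ {A B C} → ⊢ (A ⇒ B) → ⊢ (B ⇒ C) → ⊢ (A ⇒ C)
⇒-trans {A} {B} {C} p q =
  mp (mp (tautology (A ∷ B ∷ C ∷ []) (λ a b c → (a ⇒ᵇ b) ⇒ᵇ (b ⇒ᵇ c) ⇒ᵇ a ⇒ᵇ c) λ _ → refl) p) q

∧-projˡ : ∀ {A B} → ⊢ (A ∧ᶠ B ⇒ A)
∧-projˡ {A} {B} = tautology (A ∷ B ∷ []) (λ a b → a ∧ᵇ b ⇒ᵇ a) λ _ → refl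

∧-projʳ : ∀ {A B} → ⊢ (A ∧ᶠ B ⇒ B)
∧-projʳ {A} {B} = tautology (A ∷ B ∷ []) (λ a b → a ∧ᵇ b ⇒ᵇ b) λ _ → refl

∨-mapʳ : ∀ {A B C} → ⊢ (B ⇒ C) → ⊢ (A ∨ᶠ B) → ⊢ (A ∨ᶠ C)
∨-mapʳ {A} {B} {C} p q =
  mp (mp (tautology (A ∷ B ∷ C ∷ []) (λ a b c → (b ⇒ᵇ c) ⇒ᵇ (a ∨ b) ⇒ᵇ a ∨ c) λ _ → refl) p) q

×-unfoldˡ : ∀ {γ φ} → ⊢ (⟨ γ ×ᵍ ⟩ φ ⇒ φ)
×-unfoldˡ = ⇒-trans (⇔-to ax-×) ∧-projˡ

×-unfoldʳ : ∀ {γ φ} → ⊢ (⟨ γ ×ᵍ ⟩ φ ⇒ ⟨ γ ⟩ ⟨ γ ×ᵍ ⟩ φ)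
×-unfoldʳ = ⇒-trans (⇔-to ax-×) ∧-projʳ

*-least : ∀ {γ φ ψ} → ⊢ (⟨ γ ⟩ ψ ⇒ ψ) → ⊢ (φ ⇒ ψ) → ⊢ (⟨ γ * ⟩ φ ⇒ ψ)
*-least closed base = ⇒-trans (mono base) (ind-* closed)

×-greatest : ∀ {γ φ ψ} → ⊢ (ψ ⇒ ⟨ γ ⟩ ψ) → ⊢ (ψ ⇒ φ) → ⊢ (ψ ⇒ ⟨ γ ×ᵍ ⟩ φ)
×-greatest consistent base = ⇒-trans (ind-× consistent) (mono base)

infix 4 _#_

_#_ : Fm → Fm → Set
A # B = ⊢ (A ⇒ ¬ᶠ B)

#-sym : ∀ {A B} → A # B → B # A
#-sym {A} {B} = mp (tautology (A ∷ B ∷ []) (λ a b → (a ⇒ᵇ not b) ⇒ᵇ b ⇒ᵇ not a) λ _ → refl)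

#-¬ˡ : ∀ {A} → ¬ᶠ A # A
#-¬ˡ {A} = tautology (A ∷ []) (λ a → not a ⇒ᵇ not a) λ _ → refl

#-¬ʳ : ∀ {A} → A # ¬ᶠ A
#-¬ʳ = #-sym #-¬ˡ

#-weakenˡ : ∀ {A A′ B} → ⊢ (A′ ⇒ A) → A # B → A′ # B
#-weakenˡ = ⇒-trans

#-weakenʳ : ∀ {A B B′} → ⊢ (B′ ⇒ B) → A # B → A # B′
#-weakenʳ p q = #-sym (#-weakenˡ p (#-sym q))

#-resp-⇔ : ∀ {A A′ B B′} → ⊢ (A ⇔ A′) → ⊢ (B ⇔ B′) → A′ # B′ → A # B
#-resp-⇔ p q r = #-weakenˡ (⇔-to p) (#-weakenʳ (⇔-to q) r)

#-∧∨ : ∀ {A B C D} → A # B → C # D → A ∧ᶠ C # B ∨ᶠ D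
#-∧∨ {A} {B} {C} {D} p q =
  mp (mp (tautology (A ∷ B ∷ C ∷ D ∷ [])
           (λ a b c d → (a ⇒ᵇ not b) ⇒ᵇ (c ⇒ᵇ not d) ⇒ᵇ a ∧ᵇ c ⇒ᵇ not (b ∨ d))
           λ _ → refl) p) q

#-∨∧ : ∀ {A B C D} → A # B → C # D → A ∨ᶠ C # B ∧ᶠ D
#-∨∧ p q = #-sym (#-∧∨ (#-sym p) (#-sym q))

#-ᵈ : ∀ {γ A B} → A # B → ⟨ γ ᵈ ⟩ A # ⟨ γ ⟩ B
#-ᵈ A#B = #-sym (#-weakenˡ (mono (#-sym A#B)) (#-weakenʳ (⇔-to ax-d) #-¬ʳ))

-- ¬⟨γ′^×⟩A is closed under ⟨γ⟩ and follows from B, so it follows from ⟨γ*⟩B.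
#-×* : ∀ {γ′ γ A B} → (∀ {X Y} → X # Y → ⟨ γ′ ⟩ X # ⟨ γ ⟩ Y) →
       A # B → ⟨ γ′ ×ᵍ ⟩ A # ⟨ γ * ⟩ B
#-×* step A#B = #-sym (*-least (#-sym (#-weakenˡ ×-unfoldʳ (step #-¬ʳ)))
                                (#-sym (#-weakenˡ ×-unfoldˡ A#B)))

#-*× : ∀ {γ′ γ A B} → (∀ {X Y} → X # Y → ⟨ γ′ ⟩ X # ⟨ γ ⟩ Y) →
       A # B → ⟨ γ′ * ⟩ A # ⟨ γ ×ᵍ ⟩ B
#-*× step A#B = *-least (#-weakenʳ ×-unfoldʳ (step #-¬ˡ)) (#-weakenʳ ×-unfoldˡ A#B)

compl-# : ∀ φ → ⌜ compl φ ⌝ # ⌜ φ ⌝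
complᵍ-# : ∀ γ {A B} → A # B → ⟨ ⌜ complᵍ γ ⌝ᵍ ⟩ A # ⟨ ⌜ γ ⌝ᵍ ⟩ B

compl-# (pos p)   = #-¬ˡ
compl-# (neg p)   = #-¬ʳ
compl-# (φ ∨ⁿ ψ)  = #-∧∨ (compl-# φ) (compl-# ψ)
compl-# (φ ∧ⁿ ψ)  = #-∨∧ (compl-# φ) (compl-# ψ)
compl-# (⟪ γ ⟫ φ) = complᵍ-# γ (compl-# φ)

complᵍ-# (ng g)   A#B = #-ᵈ A#B
complᵍ-# (ngd g)  A#B = #-sym (#-ᵈ (#-sym A#B))
complᵍ-# (γ ︔ⁿ δ) A#B = #-resp-⇔ ax-seq ax-seq (complᵍ-# γ (complᵍ-# δ A#B))
complᵍ-# (γ ⊔ⁿ δ) A#B = #-resp-⇔ ax-⊓ ax-⊔ (#-∧∨ (complᵍ-# γ A#B) (complᵍ-# δ A#B))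
complᵍ-# (γ ⊓ⁿ δ) A#B = #-resp-⇔ ax-⊔ ax-⊓ (#-∨∧ (complᵍ-# γ A#B) (complᵍ-# δ A#B))
complᵍ-# (γ *ⁿ)   A#B = #-×* (complᵍ-# γ) A#B
complᵍ-# (γ ×ⁿ)   A#B = #-*× (complᵍ-# γ) A#B
complᵍ-# (φ ?ⁿ)   A#B = #-resp-⇔ ax-! ax-? (#-∨∧ (compl-# φ) A#B)
complᵍ-# (φ !ⁿ)   A#B = #-resp-⇔ ax-? ax-! (#-∧∨ (compl-# φ) A#B)

complΓ-# : ∀ Γ → complΓ Γ # ⋁ Γ
complΓ-# []           = #-¬ʳ
complΓ-# (ψ ∷ [])     = compl-# ψ
complΓ-# (ψ ∷ ψ′ ∷ Γ) = #-∧∨ (compl-# ψ) (complΓ-# (ψ′ ∷ Γ))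

⇒-excluding : ∀ {A B C} → ⊢ (A ∨ᶠ B) → C # A → ⊢ (C ∨ᶠ B ⇒ B)
⇒-excluding {A} {B} {C} p q =
  mp (mp (tautology (A ∷ B ∷ C ∷ [])
           (λ a b c → (a ∨ b) ⇒ᵇ (c ⇒ᵇ not a) ⇒ᵇ c ∨ b ⇒ᵇ b) λ _ → refl) p) q

guarded-×-unfold : ∀ {C γ φ} → let θ = ⟨ ((C ‼) ︔ γ) ×ᵍ ⟩ ⟨ C ‼ ⟩ φ in
                   ⊢ (θ ⇒ C ∨ᶠ (φ ∧ᶠ ⟨ γ ⟩ θ))
guarded-×-unfold {C} {γ} {φ} =
  mp (mp (mp (tautology (θ ∷ ⟨ C ‼ ⟩ φ ∷ ⟨ (C ‼) ︔ γ ⟩ θ ∷ C ∷ φ ∷ ⟨ γ ⟩ θ ∷ [])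
               (λ t p q c f g → (t ⇒ᵇ p ∧ᵇ q) ⇒ᵇ (p ⇒ᵇ c ∨ f) ⇒ᵇ (q ⇒ᵇ c ∨ g) ⇒ᵇ
                                t ⇒ᵇ c ∨ (f ∧ᵇ g))
               λ _ → refl)
             (⇔-to ax-×))
         (⇔-to ax-!))
     (⇒-trans (⇔-to ax-seq) (⇔-to ax-!))
  where θ = ⟨ ((C ‼) ︔ γ) ×ᵍ ⟩ ⟨ C ‼ ⟩ φ

lemma18 : (Γ : List NFm) (φ : NFm) (γ : NGm) →
            ⊢ (⋁ Γ ∨ᶠ (⌜ φ ⌝ ∧ᶠ ⟨ ⌜ γ ⌝ᵍ ⟩ ⟨ ((complΓ Γ ‼) ︔ ⌜ γ ⌝ᵍ) ×ᵍ ⟩ ⟨ complΓ Γ ‼ ⟩ ⌜ φ ⌝)) →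
            ⊢ (⋁ Γ ∨ᶠ ⟨ ⌜ γ ⌝ᵍ ×ᵍ ⟩ ⌜ φ ⌝)
lemma18 Γ φ γ hyp = ∨-mapʳ χ⇒γ×φ hyp
  where
  C = complΓ Γ
  θ = ⟨ ((C ‼) ︔ ⌜ γ ⌝ᵍ) ×ᵍ ⟩ ⟨ C ‼ ⟩ ⌜ φ ⌝
  χ = ⌜ φ ⌝ ∧ᶠ ⟨ ⌜ γ ⌝ᵍ ⟩ θ

  θ⇒χ : ⊢ (θ ⇒ χ)
  θ⇒χ = ⇒-trans guarded-×-unfold (⇒-excluding hyp (complΓ-# Γ))

  χ⇒γ×φ : ⊢ (χ ⇒ ⟨ ⌜ γ ⌝ᵍ ×ᵍ ⟩ ⌜ φ ⌝)
  χ⇒γ×φ = ×-greatest (⇒-trans ∧-projʳ (mono θ⇒χ)) ∧-projˡ
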